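{- Let $m,n$ be positive integers, $1\le i<m-1$, and $P\subseteq\xi^i[n]$. If $\#P\le\lfloor\frac{n-1}{2}\rfloor$, then $P\in\mathrm{APS}_{\#P}(m,n)$.
   Context: $[n]=\{1,\dots,n\}$, $\xi=e^{2\pi i/m}$; for $0\le a\le m-1$, $x\in[n]$, $\xi^a(x)$ denotes $\xi^a\cdot x$, $\xi^a[n]=\{\xi^a(1),\dots,\xi^a(n)\}$, $\mathbb{I}_n^m=\bigcup_{a=0}^{m-1}\xi^a[n]$, totally ordered by $\xi^a(x)\prec\xi^b(y)$ iff $a>b$, or $a=b$ and $x>y$. $\mathbb{Z}_m\wr S_n$ is the group of bijections $w$ of $\mathbb{I}_n^m$ with $w(\xi^i x)=\xi^i w(x)$ for $x\in[n]$ and all $i$, written $w(n)\cdots w(1)$. $\operatorname{Pin}(w)=\{w(i):2\le i\le n-1,\ w(i+1)\prec w(i)\succ w(i-1)\}$. $\mathrm{APS}_d(m,n)$ is the collection of sets $P=\operatorname{Pin}(w)$, $w\in\mathbb{Z}_m\wr S_n$, with $\#P\le d$. -}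

module Defs where

open import Data.Nat using (ℕ; _<_; _≤_; _+_)
open import Data.Fin using (Fin; toℕ; _≟_)
open import Relation.Nullary using (yes; no)
open import Data.Fin.Subset using (Subset; _∈_; ∣_∣; ⊥)
open import Data.Product using (Σ; _×_; _,_; ∃-syntax; proj₂)
open import Data.Sum using (_⊎_)
open import Data.List using (map; allFin)
open import Data.Nat.ListAction using (sum)
open import Function using (_∘_; _⇔_)
open import Function.Definitions using (Injective)
open import Relation.Binary.PropositionalEquality using (_≡_)

-- The colored alphabet I_n^m: the pair (a , x) : Fin m × Fin n stands for
-- ξ^a (x+1)  (colour a ∈ {0,…,m-1}, letter x+1 ∈ [n]).
I : ℕ → ℕ → Set
I m n = Fin m × Fin n

_≺_ : ∀ {m n} → I m n → I m n → Set
(a , x) ≺ (b , y) = (toℕ b < toℕ a) ⊎ ((a ≡ b) × (toℕ y < toℕ x))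

-- An element w of Z_m ≀ S_n, given by its values w(1),…,w(n) on [n]
-- (position k : Fin n stands for k+1); w extends uniquely to I_n^m by
-- w(ξ^i x) = ξ^i w(x), and this extension is a bijection of I_n^m exactly
-- when the underlying letters of w(1),…,w(n) are pairwise distinct.
record Wreath (m n : ℕ) : Set where
  field
    val : Fin n → I m n
    underlying-injective : Injective _≡_ _≡_ (proj₂ ∘ val)
open Wreath public

InPin : ∀ {m n} → Wreath m n → I m n → Set
InPin {m} {n} w c =
  Σ (Fin n) λ k → Σ (Fin n) λ kl → Σ (Fin n) λ kr →
    (toℕ kl + 1 ≡ toℕ k) × (toℕ k + 1 ≡ toℕ kr) ×
    (val w kr ≺ val w k) × (val w kl ≺ val w k) × (val w k ≡ c)

-- Subsets of I_n^m, as a family of subsets of [n] indexed by colour: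
-- ξ^a(x) ∈ Q  iff  x ∈ Q a.
ISubset : ℕ → ℕ → Set
ISubset m n = Fin m → Subset n

card : ∀ {m n} → ISubset m n → ℕ
card {m} Q = sum (map (λ a → ∣ Q a ∣) (allFin m))

-- P ⊆ ξ^i[n], given by the subset S ⊆ [n] with P = ξ^i S.
colourSet : ∀ {m n} → Fin m → Subset n → ISubset m n
colourSet i S a with a ≟ i
... | yes _ = S
... | no _ = ⊥

APS : (d m n : ℕ) → ISubset m n → Set
APS d m n Q =
  (∃[ w ] (∀ (a : Fin m) (x : Fin n) → (x ∈ Q a) ⇔ InPin w (a , x)))
  × (card Q ≤ d)

{-# OPTIONS --safe #-}
-- Let k = #S, S = {s₁ < ⋯ < s_k}, [n] ∖ S = {t₁ < ⋯ < t_{n-k}}, and pick a colour c > i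
-- (possible since i < m - 1).  In the signed permutation
--   w(1) ⋯ w(n) = ξ^c t₁ ξ^i s₁ ξ^c t₂ ξ^i s₂ ⋯ ξ^c t_k ξ^i s_k ξ^c t_{k+1} ⋯ ξ^c t_{n-k}
-- every letter of colour c is ≺ every letter of colour i, and the letters of colour c
-- ≺-decrease from left to right.  As k ≤ ⌊(n-1)/2⌋ forces k < n - k, every ξ^i s_j lies
-- between two letters of colour c and is a pinnacle, while no letter of colour c is one.
-- Hence Pin(w) = ξ^i S.
module Submission where

open import Defs
open import Data.Nat using (ℕ; _≤_; _<_; _∸_; _/_; suc)
open import Data.Fin using (Fin; toℕ)
open import Data.Fin.Subset using (Subset)

open import Data.Nat using (zero; _+_; _*_; z≤n; s≤s)
open import Data.Nat.Properties
  using (suc-injective; ≤-refl; +-identityʳ; +-mono-≤; *-comm; m+n≤o⇒m≤o∸n; m∸n+n≡m; module ≤-Reasoning)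
  renaming (<-irrefl to <ℕ-irrefl; <-asym to <ℕ-asym)
open import Data.Nat.DivMod using (m/n*n≤m)
open import Data.Nat.ListAction using (sum)
open import Data.Fin using (zero; suc; cast; fromℕ; _≟_) renaming (_<_ to _<ᶠ_)
open import Data.Fin.Properties using (toℕ-fromℕ; <⇒≢) renaming (suc-injective to Fin-suc-injective)
open import Data.Fin.Subset using (∁; ∣_∣; inside; outside) renaming (_∈_ to _∈ˢ_; ⊥ to ∅)
open import Data.Fin.Subset.Properties using (x∈∁p⇒x∉p; ∉⊥; ∣∁p∣≡n∸∣p∣; ∣p∣≤n; ∣⊥∣≡0)
open import Data.Vec using ([]; _∷_; here; there)
open import Data.List using (List; []; _∷_; _++_; length; map; lookup; tabulate)
open import Data.List.Properties using (length-map; length-++; map-∘; map-id; map-tabulate)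
open import Data.List.Membership.Propositional using (_∈_)
open import Data.List.Membership.Propositional.Properties using (∈-map⁺; ∈-map⁻; ∈-lookup)
open import Data.List.Relation.Unary.Any using (here; there)
import Data.List.Relation.Unary.All as All
import Data.List.Relation.Unary.All.Properties as All
open import Data.List.Relation.Unary.AllPairs as AllPairs using (AllPairs; []; _∷_)
import Data.List.Relation.Unary.AllPairs.Properties as AllPairs
open import Data.List.Relation.Unary.Linked as Linked using (Linked; [-]; _∷_)
open import Data.List.Relation.Unary.Linked.Properties as Linked using (AllPairs⇒Linked)
open import Data.List.Relation.Unary.Unique.Propositional using (Unique)
import Data.List.Relation.Unary.Unique.Propositional.Properties as Unique
open import Data.List.Relation.Binary.Permutation.Propositional using (_↭_; ↭-refl; ↭-prep; ↭-trans; ↭-sym; ↭⇒↭ₛ)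
open import Data.List.Relation.Binary.Permutation.Propositional.Properties using (++-comm; ↭-length)
import Data.List.Relation.Binary.Permutation.Setoid.Properties as Permutationₛ
open import Data.Product using (Σ; _×_; _,_; proj₁; proj₂)
open import Data.Sum using (_⊎_; inj₁; inj₂)
open import Data.Empty using (⊥-elim)
open import Function using (id; _∘_; _⇔_; mk⇔; case_of_)
open import Function.Definitions using (Injective)
open import Function.Properties.Equivalence using () renaming (trans to ⇔-trans)
open import Relation.Nullary using (¬_; yes; no)
open import Relation.Binary.PropositionalEquality

module _ {A : Set} (R : A → A → Set) where

  data Pinnacle : List A → A → Set where
    here  : ∀ {a b c xs} → R a b → R c b → Pinnacle (a ∷ b ∷ c ∷ xs) b
    there : ∀ {a b xs} → Pinnacle xs b → Pinnacle (a ∷ xs) b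

  -- InPin w is definitionally PinnacleOf _≺_ (val w).
  PinnacleOf : ∀ {n} → (Fin n → A) → A → Set
  PinnacleOf {n} f c =
    Σ (Fin n) λ k → Σ (Fin n) λ kl → Σ (Fin n) λ kr →
      (toℕ kl + 1 ≡ toℕ k) × (toℕ k + 1 ≡ toℕ kr) ×
      R (f kr) (f k) × R (f kl) (f k) × (f k ≡ c)

  pinnacle-uncons : ∀ {a b xs c} → Pinnacle (a ∷ b ∷ xs) c → (c ≡ b × R a b) ⊎ Pinnacle (b ∷ xs) c
  pinnacle-uncons (here a<b _) = inj₁ (refl , a<b)
  pinnacle-uncons (there p)    = inj₂ p

  pinnacleOf-lookup⁺ : ∀ {n xs c} (eq : n ≡ length xs) →
    Pinnacle xs c → PinnacleOf (lookup xs ∘ cast eq) c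
  pinnacleOf-lookup⁺ refl (here l r) = suc zero , zero , suc (suc zero) , refl , refl , r , l , refl
  pinnacleOf-lookup⁺ refl (there p) with pinnacleOf-lookup⁺ refl p
  ... | k , kl , kr , e₁ , e₂ , r , l , e = suc k , suc kl , suc kr , cong suc e₁ , cong suc e₂ , r , l , e

  pinnacleOf-lookup⁻ : ∀ {n} xs {c} (eq : n ≡ length xs) →
    PinnacleOf (lookup xs ∘ cast eq) c → Pinnacle xs c
  pinnacleOf-lookup⁻ (a ∷ b ∷ d ∷ xs) refl (suc zero , zero , suc (suc zero) , refl , refl , r , l , refl) = here l r
  pinnacleOf-lookup⁻ (a ∷ xs) refl (suc k , suc kl , suc kr , e₁ , e₂ , r , l , e) =
    there (pinnacleOf-lookup⁻ xs refl (k , kl , kr , suc-injective e₁ , suc-injective e₂ , r , l , e))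
  pinnacleOf-lookup⁻ (a ∷ []) refl (zero , _ , zero , _ , () , _)
  pinnacleOf-lookup⁻ (a ∷ b ∷ []) refl (zero , _ , zero , _ , () , _)
  pinnacleOf-lookup⁻ (a ∷ b ∷ []) refl (suc _ , _ , zero , _ , () , _)
  pinnacleOf-lookup⁻ (a ∷ b ∷ []) refl (suc zero , zero , suc zero , refl , () , _)
  pinnacleOf-lookup⁻ (a ∷ b ∷ []) refl (zero , zero , _ , () , _)
  pinnacleOf-lookup⁻ (a ∷ b ∷ []) refl (zero , suc _ , _ , () , _)

  no-pinnacle : ∀ {xs c} → Linked (λ a b → ¬ R a b) xs → ¬ Pinnacle xs c
  no-pinnacle (a≮b ∷ _) (here a<b _) = a≮b a<b
  no-pinnacle (_ ∷ l)   (there p)    = no-pinnacle l p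
  no-pinnacle [-]       (there ())

  pinnacle⇔pinnacleOf-lookup : ∀ {n} xs {c} (eq : n ≡ length xs) →
    Pinnacle xs c ⇔ PinnacleOf (lookup xs ∘ cast eq) c
  pinnacle⇔pinnacleOf-lookup xs eq = mk⇔ (pinnacleOf-lookup⁺ eq) (pinnacleOf-lookup⁻ xs eq)

lookup-cast-injective : ∀ {A B : Set} {n} (f : A → B) xs (eq : n ≡ length xs) →
  Unique (map f xs) → Injective _≡_ _≡_ (f ∘ lookup xs ∘ cast eq)
lookup-cast-injective f (x ∷ xs) refl (_ ∷ _) {zero} {zero} _ = refl
lookup-cast-injective f (x ∷ xs) refl (x∉ ∷ _) {zero} {suc j} e =
  ⊥-elim (All.lookup x∉ (∈-map⁺ f (∈-lookup _)) e)
lookup-cast-injective f (x ∷ xs) refl (x∉ ∷ _) {suc i} {zero} e =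
  ⊥-elim (All.lookup x∉ (∈-map⁺ f (∈-lookup _)) (sym e))
lookup-cast-injective f (x ∷ xs) refl (_ ∷ u) {suc i} {suc j} e =
  cong suc (lookup-cast-injective f xs refl u e)

interleave : {A : Set} → List A → List A → List A
interleave []       ys = ys
interleave (x ∷ xs) ys = x ∷ interleave ys xs

module _ {A : Set} where

  interleave-↭ : (xs ys : List A) → interleave xs ys ↭ xs ++ ys
  interleave-↭ []       ys = ↭-refl
  interleave-↭ (x ∷ xs) ys = ↭-prep x (↭-trans (interleave-↭ ys xs) (++-comm ys xs))

  length-interleave : (xs ys : List A) → length (interleave xs ys) ≡ length xs + length ys
  length-interleave xs ys = trans (↭-length (interleave-↭ xs ys)) (length-++ xs)

  unique-interleave : (xs ys : List A) → Unique (xs ++ ys) → Unique (interleave xs ys)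
  unique-interleave xs ys = Unique-resp-↭ (↭⇒↭ₛ (↭-sym (interleave-↭ xs ys)))
    where open Permutationₛ (setoid A) using (Unique-resp-↭)

  map-interleave : {B : Set} (f : A → B) (xs ys : List A) →
    map f (interleave xs ys) ≡ interleave (map f xs) (map f ys)
  map-interleave f []       ys = refl
  map-interleave f (x ∷ xs) ys = cong (f x ∷_) (map-interleave f ys xs)

module _ {A B : Set} (R : B → B → Set) (f g : A → B)
         (f<g : ∀ a b → R (f a) (g b)) (g≮f : ∀ a b → ¬ R (g b) (f a)) where

  pinnacle-interleave⁺ : ∀ xs ys {c} → length ys < length xs → c ∈ map g ys →
    Pinnacle R (interleave (map f xs) (map g ys)) c
  pinnacle-interleave⁺ (x ∷ x′ ∷ xs) (y ∷ ys) (s≤s (s≤s _)) (here refl) = here (f<g x y) (f<g x′ y)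
  pinnacle-interleave⁺ (x ∷ x′ ∷ xs) (y ∷ ys) (s≤s (s≤s lt)) (there c∈) =
    there (there (pinnacle-interleave⁺ (x′ ∷ xs) ys (s≤s lt) c∈))

  pinnacle-interleave⁻ : ∀ xs ys {c} → length ys < length xs → Linked (λ a b → ¬ R (f a) (f b)) xs →
    Pinnacle R (interleave (map f xs) (map g ys)) c → c ∈ map g ys
  pinnacle-interleave⁻ (x ∷ xs)      []       _              l       p          = ⊥-elim (no-pinnacle R (Linked.map⁺ l) p)
  pinnacle-interleave⁻ (x ∷ x′ ∷ xs) (y ∷ ys) (s≤s (s≤s _))  _       (here _ _) = here refl
  pinnacle-interleave⁻ (x ∷ x′ ∷ xs) (y ∷ ys) (s≤s (s≤s lt)) (_ ∷ l) (there p) with pinnacle-uncons R p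
  ... | inj₁ (refl , y<x′) = ⊥-elim (g≮f x′ y y<x′)
  ... | inj₂ p′            = there (pinnacle-interleave⁻ (x′ ∷ xs) ys (s≤s lt) l p′)

  pinnacle-interleave : ∀ xs ys {c} → length ys < length xs → Linked (λ a b → ¬ R (f a) (f b)) xs →
    c ∈ map g ys ⇔ Pinnacle R (interleave (map f xs) (map g ys)) c
  pinnacle-interleave xs ys lt l = mk⇔ (pinnacle-interleave⁺ xs ys lt) (pinnacle-interleave⁻ xs ys lt l)

elements : ∀ {n} → Subset n → List (Fin n)
elements []            = []
elements (inside ∷ p)  = zero ∷ map suc (elements p)
elements (outside ∷ p) = map suc (elements p)

∈-elements⁺ : ∀ {n} {p : Subset n} {x} → x ∈ˢ p → x ∈ elements p
∈-elements⁺ {p = inside ∷ p}  here      = here refl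
∈-elements⁺ {p = inside ∷ p}  (there x∈) = there (∈-map⁺ suc (∈-elements⁺ x∈))
∈-elements⁺ {p = outside ∷ p} (there x∈) = ∈-map⁺ suc (∈-elements⁺ x∈)

∈-elements⁻ : ∀ {n} {p : Subset n} {x} → x ∈ elements p → x ∈ˢ p
∈-elements⁻ {p = inside ∷ p} (here refl) = here
∈-elements⁻ {p = inside ∷ p} (there x∈) with ∈-map⁻ suc x∈
... | _ , y∈ , refl = there (∈-elements⁻ y∈)
∈-elements⁻ {p = outside ∷ p} x∈ with ∈-map⁻ suc x∈
... | _ , y∈ , refl = there (∈-elements⁻ y∈)

elements-increasing : ∀ {n} (p : Subset n) → AllPairs _<ᶠ_ (elements p)
elements-increasing []            = []
elements-increasing (inside ∷ p)  =
  All.map⁺ (All.universal (λ _ → s≤s z≤n) (elements p))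
    ∷ AllPairs.map⁺ (AllPairs.map s≤s (elements-increasing p))
elements-increasing (outside ∷ p) = AllPairs.map⁺ (AllPairs.map s≤s (elements-increasing p))

length-elements : ∀ {n} (p : Subset n) → length (elements p) ≡ ∣ p ∣
length-elements []            = refl
length-elements (inside ∷ p)  = cong suc (trans (length-map suc (elements p)) (length-elements p))
length-elements (outside ∷ p) = trans (length-map suc (elements p)) (length-elements p)

sum-tabulate-0 : ∀ {m} (g : Fin m → ℕ) → (∀ a → g a ≡ 0) → sum (tabulate g) ≡ 0
sum-tabulate-0 {zero}  g g≡0 = refl
sum-tabulate-0 {suc m} g g≡0 = cong₂ _+_ (g≡0 zero) (sum-tabulate-0 (g ∘ suc) (g≡0 ∘ suc))

sum-tabulate-single : ∀ {m} (g : Fin m → ℕ) i → (∀ a → a ≢ i → g a ≡ 0) → sum (tabulate g) ≡ g i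
sum-tabulate-single g zero    g≡0 =
  trans (cong (g zero +_) (sum-tabulate-0 (g ∘ suc) (λ a → g≡0 (suc a) λ ()))) (+-identityʳ (g zero))
sum-tabulate-single g (suc i) g≡0 =
  cong₂ _+_ (g≡0 zero λ ()) (sum-tabulate-single (g ∘ suc) i (λ a a≢i → g≡0 (suc a) (a≢i ∘ Fin-suc-injective)))

m≤n/2⇒m<1+n∸m : ∀ {m n} → m ≤ n / 2 → m < suc n ∸ m
m≤n/2⇒m<1+n∸m {m} {n} m≤n/2 = m+n≤o⇒m≤o∸n (suc m) (s≤s m+m≤n)
  where
  open ≤-Reasoning
  m+m≤n : m + m ≤ n
  m+m≤n = begin
    m + m             ≤⟨ +-mono-≤ m≤n/2 m≤n/2 ⟩
    n / 2 + n / 2     ≡⟨ cong (n / 2 +_) (sym (+-identityʳ (n / 2))) ⟩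
    2 * (n / 2)       ≡⟨ *-comm 2 (n / 2) ⟩
    n / 2 * 2         ≤⟨ m/n*n≤m n 2 ⟩
    n                 ∎

map-proj₂-pair : ∀ {A B : Set} (a : A) (xs : List B) → map proj₂ (map (a ,_) xs) ≡ xs
map-proj₂-pair a xs = trans (sym (map-∘ xs)) (map-id xs)

≺-asym : ∀ {m n} {p q : I m n} → p ≺ q → ¬ q ≺ p
≺-asym (inj₁ b<a)          (inj₁ a<b)        = <ℕ-asym b<a a<b
≺-asym (inj₁ b<a)          (inj₂ (refl , _)) = <ℕ-irrefl refl b<a
≺-asym (inj₂ (refl , _))   (inj₁ a<a)        = <ℕ-irrefl refl a<a
≺-asym (inj₂ (refl , y<x)) (inj₂ (_ , x<y))  = <ℕ-asym y<x x<y

module _ {m n : ℕ} (ws : List (I m n)) (n≡length : n ≡ length ws) (distinct : Unique (map proj₂ ws)) where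

  listWreath : Wreath m n
  listWreath = record
    { val                  = lookup ws ∘ cast n≡length
    ; underlying-injective = lookup-cast-injective proj₂ ws n≡length distinct
    }

  pinnacle⇔inPin-listWreath : ∀ {c} → Pinnacle _≺_ ws c ⇔ InPin listWreath c
  pinnacle⇔inPin-listWreath = pinnacle⇔pinnacleOf-lookup _≺_ ws n≡length

module _ {m n : ℕ} (i : Fin m) (S : Subset n) where

  colourSet-≢ : ∀ {a} → a ≢ i → colourSet i S a ≡ ∅
  colourSet-≢ {a} a≢i with a ≟ i
  ... | yes a≡i = ⊥-elim (a≢i a≡i)
  ... | no _    = refl

  colourSet-≡ : colourSet i S i ≡ S
  colourSet-≡ with i ≟ i
  ... | yes _  = refl
  ... | no i≢i = ⊥-elim (i≢i refl)

  ∈-colourSet : ∀ {a x} → x ∈ˢ colourSet i S a ⇔ (a , x) ∈ map (i ,_) (elements S)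
  ∈-colourSet {a} with a ≟ i
  ... | yes refl = mk⇔ (∈-map⁺ (i ,_) ∘ ∈-elements⁺) λ ax∈ → case ∈-map⁻ (i ,_) ax∈ of λ where
    (_ , y∈ , refl) → ∈-elements⁻ y∈
  ... | no a≢i   = mk⇔ (⊥-elim ∘ ∉⊥) λ ax∈ → case ∈-map⁻ (i ,_) ax∈ of λ where
    (_ , _ , eq) → ⊥-elim (a≢i (cong proj₁ eq))

card-colourSet : ∀ {m n} (i : Fin m) (S : Subset n) → card (colourSet i S) ≡ ∣ S ∣
card-colourSet {m} {n} i S = begin
  sum (map size (tabulate id)) ≡⟨ cong sum (map-tabulate id size) ⟩
  sum (tabulate size)          ≡⟨ sum-tabulate-single size i size-≢ ⟩
  size i                       ≡⟨ cong ∣_∣ (colourSet-≡ i S) ⟩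
  ∣ S ∣                        ∎
  where
  open ≡-Reasoning
  size : Fin m → ℕ
  size a = ∣ colourSet i S a ∣
  size-≢ : ∀ a → a ≢ i → size a ≡ 0
  size-≢ a a≢i = trans (cong ∣_∣ (colourSet-≢ i S a≢i)) (∣⊥∣≡0 n)

module _ {m n : ℕ} (top i : Fin m) (S : Subset n) where

  word : List (I m n)
  word = interleave (map (top ,_) (elements (∁ S))) (map (i ,_) (elements S))

  length-word : length word ≡ n
  length-word = begin
    length word
      ≡⟨ length-interleave (map (top ,_) (elements (∁ S))) (map (i ,_) (elements S)) ⟩
    length (map (top ,_) (elements (∁ S))) + length (map (i ,_) (elements S))
      ≡⟨ cong₂ _+_ (length-map (top ,_) (elements (∁ S))) (length-map (i ,_) (elements S)) ⟩
    length (elements (∁ S)) + length (elements S)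
      ≡⟨ cong₂ _+_ (trans (length-elements (∁ S)) (∣∁p∣≡n∸∣p∣ S)) (length-elements S) ⟩
    n ∸ ∣ S ∣ + ∣ S ∣
      ≡⟨ m∸n+n≡m (∣p∣≤n S) ⟩
    n ∎
    where open ≡-Reasoning

  distinct-letters-word : Unique (map proj₂ word)
  distinct-letters-word =
    subst Unique (sym letters)
      (unique-interleave (elements (∁ S)) (elements S) (Unique.++⁺ (unique (∁ S)) (unique S) disjoint))
    where
    letters : map proj₂ word ≡ interleave (elements (∁ S)) (elements S)
    letters = trans (map-interleave proj₂ (map (top ,_) (elements (∁ S))) (map (i ,_) (elements S)))
      (cong₂ interleave (map-proj₂-pair top (elements (∁ S))) (map-proj₂-pair i (elements S)))
    unique : ∀ p → Unique (elements p)
    unique p = AllPairs.map <⇒≢ (elements-increasing p)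
    disjoint : ∀ {x} → ¬ (x ∈ elements (∁ S) × x ∈ elements S)
    disjoint (x∈∁S , x∈S) = x∈∁p⇒x∉p (∈-elements⁻ {p = ∁ S} x∈∁S) (∈-elements⁻ {p = S} x∈S)

  wordWreath : Wreath m n
  wordWreath = listWreath word (sym length-word) distinct-letters-word

  pinnacle-word : toℕ i < toℕ top → ∣ S ∣ < n ∸ ∣ S ∣ → ∀ {c} →
    c ∈ map (i ,_) (elements S) ⇔ Pinnacle _≺_ word c
  pinnacle-word i<top k<n∸k =
    pinnacle-interleave _≺_ (top ,_) (i ,_) (λ _ _ → inj₁ i<top) (λ _ _ → ≺-asym (inj₁ i<top))
      (elements (∁ S)) (elements S) shorter decreasing
    where
    shorter : length (elements S) < length (elements (∁ S))
    shorter = subst₂ _<_ (sym (length-elements S)) (sym (trans (length-elements (∁ S)) (∣∁p∣≡n∸∣p∣ S))) k<n∸k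
    decreasing : Linked (λ x y → ¬ (top , x) ≺ (top , y)) (elements (∁ S))
    decreasing =
      Linked.map (λ x<y → ≺-asym (inj₂ (refl , x<y))) (AllPairs⇒Linked (elements-increasing (∁ S)))

  pin-wordWreath : toℕ i < toℕ top → ∣ S ∣ < n ∸ ∣ S ∣ → ∀ a x →
    x ∈ˢ colourSet i S a ⇔ InPin wordWreath (a , x)
  pin-wordWreath i<top k<n∸k a x =
    ⇔-trans (∈-colourSet i S)
      (⇔-trans (pinnacle-word i<top k<n∸k) (pinnacle⇔inPin-listWreath word (sym length-word) distinct-letters-word))

mainTheorem10 : (m n : ℕ) → 1 ≤ m → 1 ≤ n → (i : Fin m) → 1 ≤ toℕ i → toℕ i < m ∸ 1 →
    (S : Subset n) → card (colourSet i S) ≤ (n ∸ 1) / 2 →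
    APS (card (colourSet i S)) m n (colourSet i S)
mainTheorem10 (suc m) (suc n) _ _ i _ i<m S card≤ =
  (wordWreath top i S , pin-wordWreath top i S i<top k<n∸k) , ≤-refl
  where
  top : Fin (suc m)
  top = fromℕ m
  i<top : toℕ i < toℕ top
  i<top = subst (toℕ i <_) (sym (toℕ-fromℕ m)) i<m
  k<n∸k : ∣ S ∣ < suc n ∸ ∣ S ∣
  k<n∸k = m≤n/2⇒m<1+n∸m (subst (_≤ n / 2) (card-colourSet i S) card≤)
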